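{- Let $\Gamma$ be a locally semicomplete commutative weakly distance-regular digraph with $2,3\in T$. If $(1,2)$ is pure, then $\Gamma_{1,1}\Gamma_{1,2}=\{\Gamma_{1,2}\}$.
   Context: Digraphs are finite with arcs being ordered pairs of distinct vertices; $N^\pm(x)$ out-/in-neighbourhoods; circuits of length $r$ are paths $(w_0,\dots,w_{r-1})$ with $(w_{r-1},w_0)$ an arc; $\partial$ distance, $\tilde\partial(x,y)=(\partial(x,y),\partial(y,x))$, $\tilde\partial(\Gamma)$ its value set. Weakly distance-regular: strongly connected and the number $p^{\tilde h}_{\tilde i,\tilde j}$ of $z$ with $\tilde\partial(x,z)=\tilde i$, $\tilde\partial(z,y)=\tilde j$ depends only on $\tilde h=\tilde\partial(x,y)$; commutative: $p^{\tilde h}_{\tilde i,\tilde j}=p^{\tilde h}_{\tilde j,\tilde i}$. Locally semicomplete: each $N^+(x)$, $N^-(x)$ induces a digraph in which any two distinct vertices are joined by at least one arc. $\Gamma_{a,b}$ is the set of pairs with two-way distance $(a,b)$. An arc $(x,y)$ has type $(1,r)$ if $\partial(y,x)=r$; $T=\{q:(1,q-1)\in\tilde\partial(\Gamma)\}$. $(1,2)$ is pure if every circuit of length $3$ containing an arc of type $(1,2)$ consists of arcs of type $(1,2)$. $\Gamma_{\tilde i}\Gamma_{\tilde j}=\{\Gamma_{\tilde h}:p^{\tilde h}_{\tilde i,\tilde j}\neq0\}$. -}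

module Defs where

open import Data.Nat using (ℕ; zero; suc)
open import Data.Nat.Properties using () renaming (_≟_ to _≟ℕ_)
open import Data.Bool using (Bool; true; false; if_then_else_; _∧_)
open import Data.Fin using (Fin)
open import Data.List using (List; length; filter)
open import Data.Bool.ListAction using (any)
open import Data.List.Base using (allFin)
open import Data.Product using (_×_; _,_; ∃; ∃-syntax)
open import Data.Product.Properties using (≡-dec)
open import Data.Sum using (_⊎_)
open import Relation.Binary.PropositionalEquality using (_≡_)
open import Relation.Nullary using (¬_; Dec)
open import Relation.Nullary.Decidable using (_×-dec_)

record Digraph : Set where
  field
    n     : ℕ
    arc   : Fin n → Fin n → Bool
    irrefl : ∀ x → arc x x ≡ false

module _ (Γ : Digraph) where
  open Digraph Γ

  Arc : Fin n → Fin n → Set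
  Arc x y = arc x y ≡ true

  eqFin : Fin n → Fin n → Bool
  eqFin x y = Relation.Nullary.Decidable.⌊ Data.Fin._≟_ x y ⌋

  walkB : ℕ → Fin n → Fin n → Bool
  walkB zero x y = eqFin x y
  walkB (suc k) x y = any (λ z → arc x z ∧ walkB k z y) (allFin n)

  search : (ℕ → Bool) → ℕ → ℕ → ℕ
  search P i zero = i
  search P i (suc f) = if P i then i else search P (suc i) f

  -- distance ∂(x,y): length of a shortest walk (= shortest path) from x to y.
  -- (Value n is a sentinel for "unreachable", never used when strongly connected.)
  ∂ : Fin n → Fin n → ℕ
  ∂ x y = search (λ k → walkB k x y) 0 n

  ∂̃ : Fin n → Fin n → ℕ × ℕ
  ∂̃ x y = (∂ x y , ∂ y x)

  StronglyConnected : Set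
  StronglyConnected = ∀ x y → ∃[ k ] walkB k x y ≡ true

  _≟₂_ : (a b : ℕ × ℕ) → Dec (a ≡ b)
  _≟₂_ = ≡-dec _≟ℕ_ _≟ℕ_

  pcount : Fin n → Fin n → ℕ × ℕ → ℕ × ℕ → ℕ
  pcount x y i j = length (filter (λ z → (∂̃ x z ≟₂ i) ×-dec (∂̃ z y ≟₂ j)) (allFin n))

  WeaklyDistanceRegular : Set
  WeaklyDistanceRegular =
    StronglyConnected ×
    (∀ x y x' y' i j → ∂̃ x y ≡ ∂̃ x' y' → pcount x y i j ≡ pcount x' y' i j)

  Commutative : Set
  Commutative = ∀ x y i j → pcount x y i j ≡ pcount x y j i

  LocallySemicomplete : Set
  LocallySemicomplete =
    (∀ x u v → ¬ u ≡ v → Arc x u → Arc x v → Arc u v ⊎ Arc v u) ×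
    (∀ x u v → ¬ u ≡ v → Arc u x → Arc v x → Arc u v ⊎ Arc v u)

  InT : ℕ → Set
  InT q = ∃[ x ] ∃[ y ] ∂̃ x y ≡ (1 , Data.Nat._∸_ q 1)

  -- (1,2) pure: every circuit of length 3 containing an arc of type (1,2)
  -- consists of arcs of type (1,2).  (Quantifying over all rotations, it
  -- suffices to assume the first arc has type (1,2).)
  Pure12 : Set
  Pure12 = ∀ w₀ w₁ w₂ → Arc w₀ w₁ → Arc w₁ w₂ → Arc w₂ w₀ →
           ∂̃ w₀ w₁ ≡ (1 , 2) → (∂̃ w₁ w₂ ≡ (1 , 2)) × (∂̃ w₂ w₀ ≡ (1 , 2))

{-# OPTIONS --safe #-}
-- Let x → z be an arc of type (1,1) and z → y one of type (1,2).  Purity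
-- forbids y → x (the circuit z y x would make x → z of type (1,2)), so local
-- semicompleteness of N⁺(z) gives x → y.  Complete z → y to a circuit
-- z → y → w → z; by purity w → z has type (1,2), and the mirror argument in
-- N⁻(z) gives w → x, so ∂(y,x) = 2.  Conversely, every vertex b starts an arc
-- b → e of type (1,2), and a (1,1)-arc a → b followed by it is a witness for
-- the pair (a,e) of type (1,2); weak distance-regularity transports this
-- witness to any pair of type (1,2).
module Submission where

open import Defs
open import Data.Bool using (Bool; true; false; _∧_)
open import Data.Bool.Properties using (T-≡; T-not-≡; T-∧)
open import Data.Empty using (⊥-elim)
open import Data.Fin using (Fin; zero; suc; _≟_)
open import Data.Fin.Properties using (punchOut-injective; toℕ<n)
open import Data.List using ([]; _∷_; length; filter; allFin)
open import Data.List.Properties using (filter-some)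
open import Data.List.Membership.Propositional using (lose)
open import Data.List.Membership.Propositional.Properties using (∈-allFin)
open import Data.List.Relation.Unary.Any using (satisfied)
open import Data.List.Relation.Unary.Any.Properties using (any⁺; any⁻)
open import Data.Nat using (ℕ; zero; suc; _+_; _≤_; _<_; z≤n; s≤s; z<s; s<s)
open import Data.Nat.Properties using (+-suc; +-identityʳ; <-irrefl; ≤-<-trans; n>0⇒n≢0)
open import Data.Product using (_×_; _,_; proj₁; proj₂; ∃; ∃-syntax; swap)
open import Data.Product.Properties using (,-injectiveˡ; ,-injectiveʳ)
open import Data.Sum using (fromInj₁)
open import Function using (_∘_)
open import Function.Bundles using (module Equivalence)
open import Relation.Binary.PropositionalEquality using (_≡_; _≢_; refl; sym; trans; cong; cong₂; subst)
open import Relation.Nullary using (¬_; yes; no; contradiction)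
open import Relation.Nullary.Decidable using (toWitness; fromWitness; fromWitnessFalse; _×-dec_)
open import Relation.Unary using (Decidable)

open Equivalence using (to; from)

distinct⇒2≤ : ∀ {m} {a b : Fin m} → a ≢ b → 2 ≤ m
distinct⇒2≤ {suc (suc _)} _ = s≤s (s≤s z≤n)
distinct⇒2≤ {suc zero} {zero} {zero} a≢b = contradiction refl a≢b

distinct₃⇒3≤ : ∀ {m} {a b c : Fin m} → a ≢ b → a ≢ c → b ≢ c → 3 ≤ m
distinct₃⇒3≤ {zero} {()}
distinct₃⇒3≤ {suc _} a≢b a≢c b≢c = s≤s (distinct⇒2≤ (b≢c ∘ punchOut-injective a≢b a≢c))

module _ {A : Set} {P : A → Set} (P? : Decidable P) where

  length-filter≢0⇒∃ : ∀ xs → length (filter P? xs) ≢ 0 → ∃ P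
  length-filter≢0⇒∃ [] h = contradiction refl h
  length-filter≢0⇒∃ (x ∷ xs) h with P? x
  ... | yes px = x , px
  ... | no _ = length-filter≢0⇒∃ xs h

module _ (Γ : Digraph) where
  open Digraph Γ

  search-least : ∀ (P : ℕ → Bool) {i f} k → k < f → P (k + i) ≡ true →
                 (∀ j → j < k → P (j + i) ≡ false) → search Γ P i f ≡ k + i
  search-least P {f = suc f} zero _ Pi _ rewrite Pi = refl
  search-least P {i} {suc f} (suc k) (s<s k<f) Pk P<k rewrite P<k 0 z<s =
    trans (search-least P k k<f (shift Pk) (λ j j<k → shift (P<k (suc j) (s<s j<k))))
          (+-suc k i)
    where
    shift : ∀ {j b} → P (suc j + i) ≡ b → P (j + suc i) ≡ b
    shift {j} {b} = subst (λ m → P m ≡ b) (sym (+-suc j i))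

  search-sound : ∀ (P : ℕ → Bool) {i f k} → k < i + f → search Γ P i f ≡ k → P k ≡ true
  search-sound P {i} {zero} k<i+0 refl = contradiction k<i+0 (<-irrefl (sym (+-identityʳ i)))
  search-sound P {i} {suc f} {k} k<i+f found with P i in Pi
  ... | true = subst (λ m → P m ≡ true) found Pi
  ... | false = search-sound P {suc i} {f} (subst (k <_) (+-suc i f) k<i+f) found

  walk-zero⁻ : ∀ x y → walkB Γ 0 x y ≡ true → x ≡ y
  walk-zero⁻ _ _ w = toWitness (from T-≡ w)

  walk-zero-refl : ∀ x → walkB Γ 0 x x ≡ true
  walk-zero-refl x = to T-≡ (fromWitness {a? = x ≟ x} refl)

  walk-zero-≢ : ∀ {x y} → x ≢ y → walkB Γ 0 x y ≡ false
  walk-zero-≢ {x} {y} x≢y = to T-not-≡ (fromWitnessFalse {a? = x ≟ y} x≢y)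

  walk-suc⁻ : ∀ k x y → walkB Γ (suc k) x y ≡ true → ∃[ z ] Arc Γ x z × walkB Γ k z y ≡ true
  walk-suc⁻ k x y w
    with z , z-ok ← satisfied (any⁻ (λ z → arc x z ∧ walkB Γ k z y) (allFin n) (from T-≡ w))
    with x→z , z⇝y ← to T-∧ z-ok
    = z , to T-≡ x→z , to T-≡ z⇝y

  walk-suc⁺ : ∀ k {x z} y → Arc Γ x z → walkB Γ k z y ≡ true → walkB Γ (suc k) x y ≡ true
  walk-suc⁺ k {x} {z} y x→z z⇝y =
    to T-≡ (any⁺ (λ v → arc x v ∧ walkB Γ k v y)
                 (lose (∈-allFin z) (from T-∧ (from T-≡ x→z , from T-≡ z⇝y))))

  walk-one⁻ : ∀ x y → walkB Γ 1 x y ≡ true → Arc Γ x y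
  walk-one⁻ x y w with z , x→z , z⇝y ← walk-suc⁻ 0 x y w with refl ← walk-zero⁻ z y z⇝y = x→z

  walk-one⁺ : ∀ {x y} → Arc Γ x y → walkB Γ 1 x y ≡ true
  walk-one⁺ x→y = walk-suc⁺ 0 _ x→y (walk-zero-refl _)

  walk-one-¬Arc : ∀ {x y} → ¬ Arc Γ x y → walkB Γ 1 x y ≡ false
  walk-one-¬Arc {x} {y} x↛y with walkB Γ 1 x y in w
  ... | true = contradiction (walk-one⁻ x y w) x↛y
  ... | false = refl

  walk-two⁻ : ∀ x y → walkB Γ 2 x y ≡ true → ∃[ w ] Arc Γ x w × Arc Γ w y
  walk-two⁻ x y w with v , x→v , v⇝y ← walk-suc⁻ 1 x y w = v , x→v , walk-one⁻ v y v⇝y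

  walk-two⁺ : ∀ {x w y} → Arc Γ x w → Arc Γ w y → walkB Γ 2 x y ≡ true
  walk-two⁺ x→w w→y = walk-suc⁺ 1 _ x→w (walk-one⁺ w→y)

  ∂-least : ∀ {x y} k → k < n → walkB Γ k x y ≡ true →
            (∀ j → j < k → walkB Γ j x y ≡ false) → ∂ Γ x y ≡ k
  ∂-least {x} {y} k k<n w below =
    trans (search-least (λ j → walkB Γ j x y) {0} {n} k k<n (padded {k} w)
                        (λ j j<k → padded {j} (below j j<k)))
          (+-identityʳ k)
    where
    padded : ∀ {j b} → walkB Γ j x y ≡ b → walkB Γ (j + 0) x y ≡ b
    padded {j} {b} = subst (λ m → walkB Γ m x y ≡ b) (sym (+-identityʳ j))

  ∂-sound : ∀ {x y k} → k < n → ∂ Γ x y ≡ k → walkB Γ k x y ≡ true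
  ∂-sound {x} {y} = search-sound (λ j → walkB Γ j x y) {0} {n}

  Arc⇒≢ : ∀ {x y} → Arc Γ x y → x ≢ y
  Arc⇒≢ {x} x→x refl = contradiction (trans (sym x→x) (irrefl x)) λ ()

  ∂-refl : ∀ x → ∂ Γ x x ≡ 0
  ∂-refl x = ∂-least 0 (≤-<-trans z≤n (toℕ<n x)) (walk-zero-refl x) (λ _ ())

  Arc⇒∂≡1 : ∀ {x y} → Arc Γ x y → ∂ Γ x y ≡ 1
  Arc⇒∂≡1 x→y = ∂-least 1 (distinct⇒2≤ x≢y) (walk-one⁺ x→y) λ { _ z<s → walk-zero-≢ x≢y }
    where x≢y = Arc⇒≢ x→y

  ∂≡1⇒Arc : ∀ {x y} → ∂ Γ x y ≡ 1 → Arc Γ x y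
  ∂≡1⇒Arc {x} {y} ∂≡1 = walk-one⁻ x y (∂-sound (distinct⇒2≤ x≢y) ∂≡1)
    where
    x≢y : x ≢ y
    x≢y refl = contradiction (trans (sym (∂-refl x)) ∂≡1) λ ()

  path⇒∂≡2 : ∀ {x w y} → x ≢ y → ¬ Arc Γ x y → Arc Γ x w → Arc Γ w y → ∂ Γ x y ≡ 2
  path⇒∂≡2 x≢y x↛y x→w w→y =
    ∂-least 2 (distinct₃⇒3≤ (Arc⇒≢ x→w) x≢y (Arc⇒≢ w→y)) (walk-two⁺ x→w w→y) below
    where
    below : ∀ j → j < 2 → walkB Γ j _ _ ≡ false
    below zero _ = walk-zero-≢ x≢y
    below (suc zero) _ = walk-one-¬Arc x↛y
    below (suc (suc _)) (s<s (s<s ()))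

  ∂≡2⇒path : ∀ {x y} → 2 < n → ∂ Γ x y ≡ 2 → ∃[ w ] Arc Γ x w × Arc Γ w y
  ∂≡2⇒path {x} {y} 2<n ∂≡2 = walk-two⁻ x y (∂-sound 2<n ∂≡2)

  ∂̃-arc : ∀ {x y b} → ∂̃ Γ x y ≡ (1 , b) → Arc Γ x y
  ∂̃-arc = ∂≡1⇒Arc ∘ ,-injectiveˡ

  ∂̃-arc⁻¹ : ∀ {x y a} → ∂̃ Γ x y ≡ (a , 1) → Arc Γ y x
  ∂̃-arc⁻¹ = ∂≡1⇒Arc ∘ ,-injectiveʳ

  ∂̃-refl : ∀ x → ∂̃ Γ x x ≡ (0 , 0)
  ∂̃-refl x = cong₂ _,_ (∂-refl x) (∂-refl x)

  module _ {x y : Fin n} {i j : ℕ × ℕ} where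

    witness? : Decidable (λ z → (∂̃ Γ x z ≡ i) × (∂̃ Γ z y ≡ j))
    witness? z = (_≟₂_ Γ (∂̃ Γ x z) i) ×-dec (_≟₂_ Γ (∂̃ Γ z y) j)

    pcount≢0⇒∃ : pcount Γ x y i j ≢ 0 → ∃[ z ] ∂̃ Γ x z ≡ i × ∂̃ Γ z y ≡ j
    pcount≢0⇒∃ = length-filter≢0⇒∃ witness? (allFin n)

    ∃⇒pcount≢0 : ∀ {z} → ∂̃ Γ x z ≡ i → ∂̃ Γ z y ≡ j → pcount Γ x y i j ≢ 0
    ∃⇒pcount≢0 {z} xz zy = n>0⇒n≢0 (filter-some witness? (lose (∈-allFin z) (xz , zy)))

module _ {Γ : Digraph} (ls : LocallySemicomplete Γ) (pure : Pure12 Γ) where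

  Γ₁₁Γ₁₂⇒≢ : ∀ {x z y} → ∂̃ Γ x z ≡ (1 , 1) → ∂̃ Γ z y ≡ (1 , 2) → x ≢ y
  Γ₁₁Γ₁₂⇒≢ xz zy refl = contradiction (trans (sym (,-injectiveˡ xz)) (,-injectiveʳ zy)) λ ()

  Γ₁₁Γ₁₂⇒¬Arc⁻¹ : ∀ {x z y} → ∂̃ Γ x z ≡ (1 , 1) → ∂̃ Γ z y ≡ (1 , 2) → ¬ Arc Γ y x
  Γ₁₁Γ₁₂⇒¬Arc⁻¹ xz zy y→x =
    contradiction (trans (sym xz) (proj₂ (pure _ _ _ (∂̃-arc Γ zy) y→x (∂̃-arc Γ xz) zy))) λ ()

  Γ₁₂Γ₁₁⇒¬Arc⁻¹ : ∀ {w z x} → ∂̃ Γ w z ≡ (1 , 2) → ∂̃ Γ z x ≡ (1 , 1) → ¬ Arc Γ x w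
  Γ₁₂Γ₁₁⇒¬Arc⁻¹ wz zx x→w =
    contradiction (trans (sym zx) (proj₁ (pure _ _ _ (∂̃-arc Γ wz) (∂̃-arc Γ zx) x→w wz))) λ ()

  Γ₁₁Γ₁₂⇒Arc : ∀ {x z y} → ∂̃ Γ x z ≡ (1 , 1) → ∂̃ Γ z y ≡ (1 , 2) → Arc Γ x y
  Γ₁₁Γ₁₂⇒Arc {x} {z} {y} xz zy =
    fromInj₁ (⊥-elim ∘ Γ₁₁Γ₁₂⇒¬Arc⁻¹ xz zy)
             (proj₁ ls z x y (Γ₁₁Γ₁₂⇒≢ xz zy) (∂̃-arc⁻¹ Γ xz) (∂̃-arc Γ zy))

  Γ₁₂Γ₁₁⇒Arc : ∀ {w z x} → ∂̃ Γ w z ≡ (1 , 2) → ∂̃ Γ z x ≡ (1 , 1) → Arc Γ w x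
  Γ₁₂Γ₁₁⇒Arc {w} {z} {x} wz zx =
    fromInj₁ (⊥-elim ∘ Γ₁₂Γ₁₁⇒¬Arc⁻¹ wz zx)
             (proj₂ ls z w x w≢x (∂̃-arc Γ wz) (∂̃-arc⁻¹ Γ zx))
    where
    w≢x : w ≢ x
    w≢x refl = contradiction (trans (sym (,-injectiveʳ wz)) (,-injectiveˡ zx)) λ ()

  Γ₁₁Γ₁₂⊆Γ₁₂ : ∀ {x z y} → ∂̃ Γ x z ≡ (1 , 1) → ∂̃ Γ z y ≡ (1 , 2) → ∂̃ Γ x y ≡ (1 , 2)
  Γ₁₁Γ₁₂⊆Γ₁₂ {x} {z} {y} xz zy = cong₂ _,_ (Arc⇒∂≡1 Γ (Γ₁₁Γ₁₂⇒Arc xz zy)) ∂yx≡2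
    where
    x≢y = Γ₁₁Γ₁₂⇒≢ xz zy
    3≤n = distinct₃⇒3≤ (Arc⇒≢ Γ (∂̃-arc Γ xz)) x≢y (Arc⇒≢ Γ (∂̃-arc Γ zy))
    ∂yx≡2 : ∂ Γ y x ≡ 2
    ∂yx≡2 with w , y→w , w→z ← ∂≡2⇒path Γ 3≤n (,-injectiveʳ zy)
      = path⇒∂≡2 Γ (x≢y ∘ sym) (Γ₁₁Γ₁₂⇒¬Arc⁻¹ xz zy) y→w
                 (Γ₁₂Γ₁₁⇒Arc (proj₂ (pure z y w (∂̃-arc Γ zy) y→w w→z zy)) (cong swap xz))

module _ {Γ : Digraph} (wdr : WeaklyDistanceRegular Γ) where

  pcount≢0-transport : ∀ {x y x′ y′ i j} → ∂̃ Γ x y ≡ ∂̃ Γ x′ y′ →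
                       pcount Γ x y i j ≢ 0 → pcount Γ x′ y′ i j ≢ 0
  pcount≢0-transport xy≡x′y′ p≢0 = p≢0 ∘ trans (proj₂ wdr _ _ _ _ _ _ xy≡x′y′)

  ∂̃-realised-from-every-vertex : ∀ {c d h} → ∂̃ Γ c d ≡ h → ∀ b → ∃[ e ] ∂̃ Γ b e ≡ h
  ∂̃-realised-from-every-vertex {c} {d} cd b =
    let e , be , _ = pcount≢0⇒∃ Γ (pcount≢0-transport cc≡bb (∃⇒pcount≢0 Γ cd (cong swap cd)))
    in e , be
    where
    cc≡bb : ∂̃ Γ c c ≡ ∂̃ Γ b b
    cc≡bb = trans (∂̃-refl Γ c) (sym (∂̃-refl Γ b))

lemma2p9 : (Γ : Digraph) → LocallySemicomplete Γ → WeaklyDistanceRegular Γ →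
           Commutative Γ → InT Γ 2 → InT Γ 3 → Pure12 Γ →
           ∀ x y → ((¬ pcount Γ x y (1 , 1) (1 , 2) ≡ 0) → ∂̃ Γ x y ≡ (1 , 2))
                 × (∂̃ Γ x y ≡ (1 , 2) → ¬ pcount Γ x y (1 , 1) (1 , 2) ≡ 0)
lemma2p9 Γ ls wdr _ (_ , b , ab) (_ , _ , cd) pure x y = Γ₁₁Γ₁₂-only-Γ₁₂ , Γ₁₂-in-Γ₁₁Γ₁₂
  where
  Γ₁₁Γ₁₂-only-Γ₁₂ : pcount Γ x y (1 , 1) (1 , 2) ≢ 0 → ∂̃ Γ x y ≡ (1 , 2)
  Γ₁₁Γ₁₂-only-Γ₁₂ p≢0 = let _ , xz , zy = pcount≢0⇒∃ Γ p≢0 in Γ₁₁Γ₁₂⊆Γ₁₂ ls pure xz zy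

  Γ₁₂-in-Γ₁₁Γ₁₂ : ∂̃ Γ x y ≡ (1 , 2) → pcount Γ x y (1 , 1) (1 , 2) ≢ 0
  Γ₁₂-in-Γ₁₁Γ₁₂ xy =
    let e , be = ∂̃-realised-from-every-vertex wdr cd b
        ae = Γ₁₁Γ₁₂⊆Γ₁₂ ls pure ab be
    in pcount≢0-transport wdr (trans ae (sym xy)) (∃⇒pcount≢0 Γ ab be)
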